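{- Let $S=(a_h)_{h\in\mathbb{Z}}\subset\{+1,-1\}$ and suppose that for each $n\in\mathbb{N}$ there exists $h_n\in\mathbb{Z}$ with $a_{h_n+k2^{n+1}}=(-1)^k a_{h_n}$ for each $k\in\mathbb{Z}$. Put $E_n=h_n+2^n\mathbb{Z}$ and $F_n=h_n+2^{n+1}\mathbb{Z}$. Then for each $n\in\mathbb{N}$: (1) $\mathbb{Z}\setminus E_n=\{h\in\mathbb{Z}: a_{h+k2^{n+1}}=a_h \text{ for each } k\in\mathbb{Z}\}$, and $\mathbb{Z}\setminus E_n$ is the disjoint union of $F_0,\dots,F_{n-1}$; (2) for each $h\in E_n$, $(a_{h-2^n+1},\dots,a_{h+2^n-1})$ is an $(n+1)$-folding sequence; (3) for each $h\in\mathbb{Z}$, if $(a_{h-2^{n+1}+1},\dots,a_{h+2^{n+1}-1})$ is an $(n+2)$-folding sequence, then $h\in E_n$.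
   Context: For a finite sequence $S=(a_1,\dots,a_n)\subset\{+1,-1\}$ write $\overline{S}=(-a_n,\dots,-a_1)$. The $n$-folding sequences are defined recursively: the only $0$-folding sequence is the empty sequence, and the $(n+1)$-folding sequences are exactly $(\overline{S},+1,S)$ and $(\overline{S},-1,S)$ with $S$ an $n$-folding sequence. $\mathbb{N}=\{0,1,2,\dots\}$. -}

module Defs where

open import Data.Nat as ℕ using (ℕ; zero; suc; _^_)
open import Data.Integer as ℤ using (ℤ; +_; ∣_∣)
open import Data.Sign using (Sign; opposite) renaming (+ to plus; - to minus)
open import Data.List using (List; []; _∷_; _++_; reverse; map; upTo)
open import Data.Product using (∃; _,_)
open import Relation.Binary.PropositionalEquality using (_≡_)

bar : List Sign → List Sign
bar S = reverse (map opposite S)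

data Folding : ℕ → List Sign → Set where
  fold0 : Folding zero []
  foldS : ∀ {n S} → Folding n S → (b : Sign) → Folding (suc n) (bar S ++ (b ∷ S))

npow : ℕ → Sign
npow zero = plus
npow (suc m) = opposite (npow m)

negOnePow : ℤ → Sign
negOnePow k = npow ∣ k ∣

two^ : ℕ → ℤ
two^ m = + (2 ^ m)

InCoset : ℤ → ℤ → ℤ → Set
InCoset c d h = ∃ λ (k : ℤ) → h ≡ c ℤ.+ k ℤ.* d

window : (ℤ → Sign) → ℤ → ℕ → List Sign
window a s len = map (λ i → a (s ℤ.+ + i)) (upTo len)

module Submission where

-- The hypothesis makes a
-- antiperiodic with period 2^(n+1) on F n, hence 2^(p+1)-periodic on F n for
-- every p > n.  Consequently the cosets F n are pairwise disjoint, and an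
-- induction on n shows that every point lies in E n or in one of F 0 … F (n-1),
-- and that E (n+1) = E n ∖ F n.  Part (1) follows: off E n the sequence is
-- 2^(n+1)-periodic, while no point of E n is.
--
-- For part (2) we look at balls: 'ball a c L' lists a(c-L), …, a(c+L).  A ball
-- of radius 2L+1 consists of the balls of radius L about c ∓ (L+1), joined at
-- a c.  For h ∈ E (n+1) both h ∓ 2^n lie in F n, so these two centres carry
-- opposite signs, and the right arms of the two balls agree since they run
-- over points off E n, where a is 2^(n+1)-periodic.  Hence the left ball is
-- the bar of the right one, and induction on n yields the folding structure.
-- For part (3): a folding ball is antisymmetric about its centre h, while a is
-- symmetric about each point of F j at distance 2^(j+1); so h lies in no F j
-- with j < n, i.e. h ∈ E n by the cover.

open import Defs
open import Data.Nat as ℕ using (ℕ; zero; suc; _<_; _≤_; _≤′_; ≤′-refl; ≤′-step; _^_; _∸_; s≤s)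
import Data.Nat.Properties as ℕP
open import Data.Integer as ℤ using (ℤ; +_; -[1+_]; _+_; _-_; _*_; -_; ∣_∣; _/_; _%_)
import Data.Integer.Properties as ℤP
open import Data.Integer.DivMod using (a≡a%n+[a/n]*n; n%d<d)
open import Data.Integer.Tactic.RingSolver using (solve-∀)
open import Data.Sign as S using (Sign; opposite) renaming (_*_ to _*ˢ_)
import Data.Sign.Properties as SP
open import Data.List using (List; []; _∷_; _++_; [_]; _∷ʳ_; reverse; map; length; upTo; applyUpTo)
import Data.List.Properties as LP
open import Data.List.Relation.Unary.All.Properties using (applyUpTo⁺₁)
open import Data.Product using (∃; _×_; _,_; proj₁; proj₂)
open import Data.Sum using (_⊎_; inj₁; inj₂)
open import Data.Empty using (⊥; ⊥-elim)
open import Function.Base using (_∘_)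
open import Function.Bundles using (_⇔_; mk⇔)
open import Relation.Nullary using (¬_)
open import Relation.Binary.Definitions using (tri<; tri≈; tri>)
open import Relation.Binary.PropositionalEquality
  using (_≡_; refl; sym; trans; cong; cong₂; subst; module ≡-Reasoning)
open ≡-Reasoning

two^-suc : ∀ p → two^ (suc p) ≡ two^ p + two^ p
two^-suc p = trans (cong (λ m → + (2 ^ p ℕ.+ m)) (ℕP.+-identityʳ (2 ^ p))) (ℤP.pos-+ (2 ^ p) (2 ^ p))

double-step : ∀ x k p → x + k * two^ (suc p) ≡ x + (k + k) * two^ p
double-step x k p = trans (cong (λ t → x + k * t) (two^-suc p)) (ring x k (two^ p))
  where ring : ∀ x k t → x + k * (t + t) ≡ x + (k + k) * t
        ring = solve-∀

steps-add : ∀ x k j p → x + k * two^ p + j * two^ p ≡ x + (k + j) * two^ p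
steps-add x k j p = ring x k j (two^ p)
  where ring : ∀ x k j t → x + k * t + j * t ≡ x + (k + j) * t
        ring = solve-∀

-- radius n = 2^n - 1, the radius of a ball carrying an (n+1)-folding sequence;
-- the recursion radius (n+1) = radius n + 1 + radius n mirrors the folding.
radius : ℕ → ℕ
radius zero = zero
radius (suc n) = radius n ℕ.+ suc (radius n)

suc-radius : ∀ n → suc (radius n) ≡ 2 ^ n
suc-radius zero = refl
suc-radius (suc n) =
  cong₂ ℕ._+_ (suc-radius n) (trans (suc-radius n) (sym (ℕP.+-identityʳ (2 ^ n))))

two^-radius : ∀ n → two^ n ≡ + suc (radius n)
two^-radius n = cong +_ (sym (suc-radius n))

radius-mono : ∀ {m n} → m ≤′ n → radius m ≤ radius n
radius-mono ≤′-refl = ℕP.≤-refl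
radius-mono (≤′-step m≤n) = ℕP.≤-trans (radius-mono m≤n) (ℕP.m≤m+n _ _)

opposite-swap : ∀ s t → opposite s *ˢ t ≡ s *ˢ opposite t
opposite-swap S.+ t = refl
opposite-swap S.- t = sym (SP.opposite-involutive t)

negOnePow-suc : ∀ k → negOnePow (k + + 1) ≡ opposite (negOnePow k)
negOnePow-suc (+ n) = cong npow (ℕP.+-comm n 1)
negOnePow-suc -[1+ zero ] = refl
negOnePow-suc -[1+ suc n ] = sym (SP.opposite-involutive _)

negOnePow-+-pos : ∀ k n → negOnePow (k + + n) ≡ negOnePow k *ˢ npow n
negOnePow-+-pos k zero = trans (cong negOnePow (ℤP.+-identityʳ k)) (sym (SP.*-identityʳ _))
negOnePow-+-pos k (suc n) = begin
  negOnePow (k + + suc n)               ≡⟨ cong negOnePow (sym (ℤP.+-assoc k (+ 1) (+ n))) ⟩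
  negOnePow (k + + 1 + + n)             ≡⟨ negOnePow-+-pos (k + + 1) n ⟩
  negOnePow (k + + 1) *ˢ npow n         ≡⟨ cong (_*ˢ npow n) (negOnePow-suc k) ⟩
  opposite (negOnePow k) *ˢ npow n      ≡⟨ opposite-swap (negOnePow k) (npow n) ⟩
  negOnePow k *ˢ npow (suc n)           ∎

-- k ↦ (-1)^k is a homomorphism from (ℤ, +) to the signs; the negative case
-- follows from the nonnegative one since every sign is its own inverse.
negOnePow-+ : ∀ k j → negOnePow (k + j) ≡ negOnePow k *ˢ negOnePow j
negOnePow-+ k (+ n) = negOnePow-+-pos k n
negOnePow-+ k -[1+ n ] = begin
  negOnePow k′                          ≡⟨ sym (SP.*-identityʳ _) ⟩
  negOnePow k′ *ˢ S.+                   ≡⟨ cong (negOnePow k′ *ˢ_) (sym (SP.s*s≡+ u)) ⟩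
  negOnePow k′ *ˢ (u *ˢ u)              ≡⟨ sym (SP.*-assoc (negOnePow k′) u u) ⟩
  (negOnePow k′ *ˢ u) *ˢ u              ≡⟨ cong (_*ˢ u) (sym k-via-k′) ⟩
  negOnePow k *ˢ u                      ∎
  where
  k′ = k + -[1+ n ]
  u = npow (suc n)
  ring : ∀ k j → k ≡ k + j + - j
  ring = solve-∀
  k-via-k′ : negOnePow k ≡ negOnePow k′ *ˢ u
  k-via-k′ = trans (cong negOnePow (ring k -[1+ n ])) (negOnePow-+-pos k′ (suc n))

negOnePow-double : ∀ k → negOnePow (k + k) ≡ S.+
negOnePow-double k = trans (negOnePow-+ k k) (SP.s*s≡+ (negOnePow k))

-- x ≡ y [mod2^ p ] says x ∈ y + 2^p ℤ; the wrapper records p so that it can be inferred.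
infix 4 _≡_[mod2^_]
record _≡_[mod2^_] (x y : ℤ) (p : ℕ) : Set where
  constructor congruent
  field coset : InCoset y (two^ p) x
open _≡_[mod2^_] using (coset)

≡mod-refl : ∀ {x p} → x ≡ x [mod2^ p ]
≡mod-refl {x} {p} = congruent (+ 0 , ring x (two^ p))
  where ring : ∀ x t → x ≡ x + + 0 * t
        ring = solve-∀

≡mod-sym : ∀ {x y p} → x ≡ y [mod2^ p ] → y ≡ x [mod2^ p ]
≡mod-sym {y = y} {p} (congruent (k , refl)) = congruent (- k , ring y k (two^ p))
  where ring : ∀ y k t → y ≡ y + k * t + - k * t
        ring = solve-∀

≡mod-trans : ∀ {x y z p} → x ≡ y [mod2^ p ] → y ≡ z [mod2^ p ] → x ≡ z [mod2^ p ]
≡mod-trans {z = z} {p} (congruent (k , refl)) (congruent (j , refl)) = congruent (j + k , steps-add z j k p)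

≡mod-shift : ∀ {x y p} → x ≡ y [mod2^ p ] → ∀ j → x + j * two^ p ≡ y [mod2^ p ]
≡mod-shift {y = y} {p} (congruent (k , refl)) j = congruent (k + j , steps-add y k j p)

≡mod-weaken : ∀ {x y p} → x ≡ y [mod2^ suc p ] → x ≡ y [mod2^ p ]
≡mod-weaken {y = y} {p} (congruent (k , refl)) = congruent (k + k , double-step y k p)

≡mod-split : ∀ {x y p} → x ≡ y [mod2^ p ] →
             x ≡ y [mod2^ suc p ] ⊎ x ≡ y + two^ p [mod2^ suc p ]
≡mod-split {y = y} {p} (congruent (k , refl)) with k % + 2 | n%d<d k (+ 2) | a≡a%n+[a/n]*n k (+ 2)
... | 0 | _ | k≡ = inj₁ (congruent (k / + 2 , even))
  where
  ring : ∀ y q t → y + (+ 0 + q * + 2) * t ≡ y + (q + q) * t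
  ring = solve-∀
  even : y + k * two^ p ≡ y + (k / + 2) * two^ (suc p)
  even = trans (cong (λ z → y + z * two^ p) k≡)
               (trans (ring y (k / + 2) (two^ p)) (sym (double-step y (k / + 2) p)))
... | 1 | _ | k≡ = inj₂ (congruent (k / + 2 , odd))
  where
  ring : ∀ y q t → y + (+ 1 + q * + 2) * t ≡ y + t + (q + q) * t
  ring = solve-∀
  odd : y + k * two^ p ≡ y + two^ p + (k / + 2) * two^ (suc p)
  odd = trans (cong (λ z → y + z * two^ p) k≡)
              (trans (ring y (k / + 2) (two^ p)) (sym (double-step (y + two^ p) (k / + 2) p)))
... | suc (suc _) | s≤s (s≤s ()) | _

offset-incongruent : ∀ {x d p} → suc d < 2 ^ p → ¬ (x + + suc d ≡ x [mod2^ p ])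
offset-incongruent {x} {d} {p} small (congruent (k , eq)) =
  no-multiple ∣ k ∣ (trans (cong ∣_∣ offset≡) (ℤP.abs-* k (two^ p)))
  where
  cancel : ∀ x y → y ≡ x + y - x
  cancel = solve-∀
  offset≡ : + suc d ≡ k * two^ p
  offset≡ = trans (cancel x (+ suc d)) (trans (cong (_- x) eq) (sym (cancel x (k * two^ p))))
  no-multiple : ∀ m → suc d ≡ m ℕ.* 2 ^ p → ⊥
  no-multiple zero ()
  no-multiple (suc m) e = ℕP.<⇒≱ small (subst (2 ^ p ≤_) (sym e) (ℕP.m≤m+n (2 ^ p) (m ℕ.* 2 ^ p)))

across : ∀ h m → h - two^ m + + 1 * two^ (suc m) ≡ h + two^ m
across h m = trans (cong (λ T → h - two^ m + + 1 * T) (two^-suc m)) (ring h (two^ m))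
  where ring : ∀ h t → h - t + + 1 * (t + t) ≡ h + t
        ring = solve-∀

Periodic : (ℤ → Sign) → ℕ → ℤ → Set
Periodic a p h = ∀ k → a (h + k * two^ p) ≡ a h

periodic-double : ∀ a p h → Periodic a p h → Periodic a (suc p) h
periodic-double a p h per k = trans (cong a (double-step h k p)) (per (k + k))

periodic-mono : ∀ a h {p q} → p ≤′ q → Periodic a p h → Periodic a q h
periodic-mono a h ≤′-refl per = per
periodic-mono a h (≤′-step {n = q} p≤q) per = periodic-double a q h (periodic-mono a h p≤q per)

periodic-transfer : ∀ a {p h x} → Periodic a p h → x ≡ h [mod2^ p ] → Periodic a p x
periodic-transfer a {p} {h} per (congruent (q , refl)) k =
  trans (cong a (steps-add h q k p)) (trans (per (q + k)) (sym (per q)))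

window-cong : ∀ a s s′ N → (∀ {i} → i < N → a (s + + i) ≡ a (s′ + + i)) →
              window a s N ≡ window a s′ N
window-cong a s s′ N pointwise = LP.map-cong-local (applyUpTo⁺₁ (λ i → i) N pointwise)

length-window : ∀ a s N → length (window a s N) ≡ N
length-window a s N = trans (LP.length-map _ (upTo N)) (LP.length-upTo N)

window-suc : ∀ a s N → window a s (suc N) ≡ a (s + + 0) ∷ window a (s + + 1) N
window-suc a s N = cong (a (s + + 0) ∷_) (begin
  map f (applyUpTo suc N)    ≡⟨ cong (map f) (sym (LP.map-upTo suc N)) ⟩
  map f (map suc (upTo N))   ≡⟨ sym (LP.map-∘ (upTo N)) ⟩
  map (f ∘ suc) (upTo N)     ≡⟨ LP.map-cong (λ i → cong a (sym (ℤP.+-assoc s (+ 1) (+ i)))) (upTo N) ⟩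
  window a (s + + 1) N       ∎)
  where f = λ i → a (s + + i)

window-split : ∀ a s m n →
  window a s (m ℕ.+ suc n) ≡ window a s m ++ a (s + + m) ∷ window a (s + + suc m) n
window-split a s zero n = window-suc a s n
window-split a s (suc m) n = begin
  window a s (suc (m ℕ.+ suc n))
    ≡⟨ window-suc a s (m ℕ.+ suc n) ⟩
  a (s + + 0) ∷ window a s₁ (m ℕ.+ suc n)
    ≡⟨ cong (a (s + + 0) ∷_) (window-split a s₁ m n) ⟩
  a (s + + 0) ∷ (window a s₁ m ++ a (s₁ + + m) ∷ window a (s₁ + + suc m) n)
    ≡⟨ cong₂ (λ x y → a (s + + 0) ∷ (window a s₁ m ++ a x ∷ window a y n))
             (ℤP.+-assoc s (+ 1) (+ m)) (ℤP.+-assoc s (+ 1) (+ suc m)) ⟩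
  a (s + + 0) ∷ (window a s₁ m ++ a (s + + suc m) ∷ window a (s + + suc (suc m)) n)
    ≡⟨ cong (_++ a (s + + suc m) ∷ window a (s + + suc (suc m)) n) (sym (window-suc a s m)) ⟩
  window a s (suc m) ++ a (s + + suc m) ∷ window a (s + + suc (suc m)) n
    ∎
  where s₁ = s + + 1

ball : (ℤ → Sign) → ℤ → ℕ → List Sign
ball a c L = window a (c - + L) (L ℕ.+ suc L)

ball-arms : ∀ a c L → ball a c L ≡ window a (c - + L) L ++ a c ∷ window a (c + + 1) L
ball-arms a c L = trans (window-split a (c - + L) L L)
  (cong₂ (λ x y → window a (c - + L) L ++ a x ∷ window a y L) (back c (+ L)) (one-past c (+ L)))
  where back : ∀ c x → c - x + x ≡ c
        back = solve-∀
        one-past : ∀ c x → c - x + (+ 1 + x) ≡ c + + 1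
        one-past = solve-∀

ball-double : ∀ a c L →
  ball a c (L ℕ.+ suc L) ≡ ball a (c - + suc L) L ++ a c ∷ ball a (c + + suc L) L
ball-double a c L = trans (ball-arms a c (L ℕ.+ suc L))
  (cong₂ (λ x y → window a x (L ℕ.+ suc L) ++ a c ∷ window a y (L ℕ.+ suc L)) left right)
  where
  ring₁ : ∀ c x y → c - (x + y) ≡ c - y - x
  ring₁ = solve-∀
  left : c - + (L ℕ.+ suc L) ≡ c - + suc L - + L
  left = trans (cong (λ x → c - x) (ℤP.pos-+ L (suc L))) (ring₁ c (+ L) (+ suc L))
  ring₂ : ∀ c x → c + + 1 ≡ c + (+ 1 + x) - x
  ring₂ = solve-∀
  right : c + + 1 ≡ c + + suc L - + L
  right = ring₂ c (+ L)

length-bar : ∀ xs → length (bar xs) ≡ length xs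
length-bar xs = trans (LP.length-reverse (map opposite xs)) (LP.length-map opposite xs)

bar-involutive : ∀ xs → bar (bar xs) ≡ xs
bar-involutive xs = begin
  reverse (map opposite (reverse (map opposite xs))) ≡⟨ cong reverse (LP.reverse-map opposite (map opposite xs)) ⟩
  reverse (reverse (map opposite (map opposite xs))) ≡⟨ LP.reverse-involutive _ ⟩
  map opposite (map opposite xs)                     ≡⟨ sym (LP.map-∘ xs) ⟩
  map (opposite ∘ opposite) xs                       ≡⟨ LP.map-cong SP.opposite-involutive xs ⟩
  map (λ s → s) xs                                   ≡⟨ LP.map-id xs ⟩
  xs                                                 ∎

bar-split : ∀ xs y ys → bar (xs ++ y ∷ ys) ≡ bar ys ++ opposite y ∷ bar xs
bar-split xs y ys = begin
  reverse (map opposite (xs ++ y ∷ ys))                  ≡⟨ cong reverse (LP.map-++ opposite xs (y ∷ ys)) ⟩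
  reverse (map opposite xs ++ opposite y ∷ map opposite ys) ≡⟨ LP.reverse-++ (map opposite xs) _ ⟩
  reverse (opposite y ∷ map opposite ys) ++ bar xs       ≡⟨ cong (_++ bar xs) (LP.unfold-reverse (opposite y) (map opposite ys)) ⟩
  (bar ys ∷ʳ opposite y) ++ bar xs                       ≡⟨ LP.++-assoc (bar ys) [ opposite y ] (bar xs) ⟩
  bar ys ++ opposite y ∷ bar xs                          ∎

bar-antisymmetric : ∀ ys y → bar (bar ys ++ y ∷ ys) ≡ bar ys ++ opposite y ∷ ys
bar-antisymmetric ys y =
  trans (bar-split (bar ys) y ys) (cong (λ zs → bar ys ++ opposite y ∷ zs) (bar-involutive ys))

++-∷-injective : ∀ {A : Set} (xs xs′ : List A) {y y′ ys ys′} → length xs ≡ length xs′ →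
                 xs ++ y ∷ ys ≡ xs′ ++ y′ ∷ ys′ → xs ≡ xs′ × y ≡ y′ × ys ≡ ys′
++-∷-injective [] [] _ e = refl , LP.∷-injective e
++-∷-injective [] (_ ∷ _) () _
++-∷-injective (_ ∷ _) [] () _
++-∷-injective (x ∷ xs) (x′ ∷ xs′) l e with LP.∷-injective e
... | refl , e′ with ++-∷-injective xs xs′ (ℕP.suc-injective l) e′
...   | refl , rest = refl , rest

folding-length : ∀ {n S} → Folding n S → length S ≡ radius n
folding-length fold0 = refl
folding-length (foldS {S = T} f b) = trans (LP.length-++ (bar T))
  (cong₂ (λ l m → l ℕ.+ suc m) (trans (length-bar T) (folding-length f)) (folding-length f))

unfold-centre : ∀ {n S xs y ys} → Folding (suc n) S → S ≡ xs ++ y ∷ ys →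
                length xs ≡ radius n → xs ≡ bar ys × Folding n ys
unfold-centre (foldS {S = T} f b) e lxs
  with ++-∷-injective (bar T) _ (trans (length-bar T) (trans (folding-length f) (sym lxs))) e
... | refl , _ , refl = refl , f

folding-ball-antisymmetric : ∀ a c n → Folding (suc n) (ball a c (radius n)) →
  window a (c - + radius n) (radius n) ≡ bar (window a (c + + 1) (radius n))
folding-ball-antisymmetric a c n f =
  proj₁ (unfold-centre f (ball-arms a c (radius n)) (length-window a (c - + radius n) (radius n)))

folding-ball-centred : ∀ a c n → Folding (suc n) (ball a c (radius n)) →
  ball a c (radius n) ≡ bar (window a (c + + 1) (radius n)) ++ a c ∷ window a (c + + 1) (radius n)
folding-ball-centred a c n f =
  trans (ball-arms a c (radius n))
        (cong (_++ a c ∷ window a (c + + 1) (radius n)) (folding-ball-antisymmetric a c n f))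

-- Pointwise antisymmetry: if the arms of length L = p + 1 + q about c are
-- antisymmetric, then a(c - (q+1)) = -a(c + (q+1)); both lists are split at entry p.
antisymmetric-at : ∀ a c p q →
  window a (c - + (p ℕ.+ suc q)) (p ℕ.+ suc q) ≡ bar (window a (c + + 1) (p ℕ.+ suc q)) →
  a (c - + suc q) ≡ opposite (a (c + + suc q))
antisymmetric-at a c p q mirror = begin
  a (c - + suc q)              ≡⟨ cong a (sym left-entry) ⟩
  a (s + + p)                  ≡⟨ proj₁ (proj₂ (++-∷-injective _ _ lengths splitting)) ⟩
  opposite (a (c₁ + + q))      ≡⟨ cong (opposite ∘ a) (ℤP.+-assoc c (+ 1) (+ q)) ⟩
  opposite (a (c + + suc q))   ∎
  where
  s = c - + (p ℕ.+ suc q)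
  c₁ = c + + 1
  swap : p ℕ.+ suc q ≡ q ℕ.+ suc p
  swap = trans (ℕP.+-suc p q) (trans (cong suc (ℕP.+-comm p q)) (sym (ℕP.+-suc q p)))
  splitting : window a s p ++ a (s + + p) ∷ window a (s + + suc p) q
            ≡ bar (window a (c₁ + + suc q) p) ++ opposite (a (c₁ + + q)) ∷ bar (window a c₁ q)
  splitting = begin
    window a s p ++ a (s + + p) ∷ window a (s + + suc p) q ≡⟨ sym (window-split a s p q) ⟩
    window a s (p ℕ.+ suc q)                              ≡⟨ mirror ⟩
    bar (window a c₁ (p ℕ.+ suc q))                       ≡⟨ cong (bar ∘ window a c₁) swap ⟩
    bar (window a c₁ (q ℕ.+ suc p))                       ≡⟨ cong bar (window-split a c₁ q p) ⟩
    bar (window a c₁ q ++ a (c₁ + + q) ∷ window a (c₁ + + suc q) p)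
      ≡⟨ bar-split (window a c₁ q) (a (c₁ + + q)) (window a (c₁ + + suc q) p) ⟩
    bar (window a (c₁ + + suc q) p) ++ opposite (a (c₁ + + q)) ∷ bar (window a c₁ q) ∎
  lengths : length (window a s p) ≡ length (bar (window a (c₁ + + suc q) p))
  lengths = trans (length-window a s p)
                  (sym (trans (length-bar (window a (c₁ + + suc q) p)) (length-window a (c₁ + + suc q) p)))
  ring : ∀ c x y → c - (x + y) + x ≡ c - y
  ring = solve-∀
  left-entry : s + + p ≡ c - + suc q
  left-entry = trans (cong (λ z → c - z + + p) (ℤP.pos-+ p (suc q))) (ring c (+ p) (+ suc q))

window≡ball : ∀ a h n → window a (h - two^ n + + 1) (2 ^ suc n ∸ 1) ≡ ball a h (radius n)
window≡ball a h n = cong₂ (window a) start (cong (_∸ 1) (sym (suc-radius (suc n))))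
  where ring : ∀ h x → h - (+ 1 + x) + + 1 ≡ h - x
        ring = solve-∀
        start : h - two^ n + + 1 ≡ h - + radius n
        start = trans (cong (λ t → h - t + + 1) (two^-radius n)) (ring h (+ radius n))

module Antiperiodic (a : ℤ → Sign) (hs : ℕ → ℤ)
  (antiperiodic-at-hs : ∀ (n : ℕ) (k : ℤ) → a (hs n + k * two^ (suc n)) ≡ negOnePow k *ˢ a (hs n)) where

  E : ℕ → ℤ → Set
  E n h = h ≡ hs n [mod2^ n ]

  F : ℕ → ℤ → Set
  F n h = h ≡ hs n [mod2^ suc n ]

  antiperiodic : ∀ {m x} → F m x → ∀ j → a (x + j * two^ (suc m)) ≡ negOnePow j *ˢ a x
  antiperiodic {m} (congruent (k , refl)) j = begin
    a (hs m + k * T + j * T)                  ≡⟨ cong a (steps-add (hs m) k j (suc m)) ⟩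
    a (hs m + (k + j) * T)                    ≡⟨ antiperiodic-at-hs m (k + j) ⟩
    negOnePow (k + j) *ˢ a (hs m)             ≡⟨ cong (_*ˢ a (hs m)) (negOnePow-+ k j) ⟩
    (negOnePow k *ˢ negOnePow j) *ˢ a (hs m)  ≡⟨ cong (_*ˢ a (hs m)) (SP.*-comm (negOnePow k) (negOnePow j)) ⟩
    (negOnePow j *ˢ negOnePow k) *ˢ a (hs m)  ≡⟨ SP.*-assoc (negOnePow j) (negOnePow k) (a (hs m)) ⟩
    negOnePow j *ˢ (negOnePow k *ˢ a (hs m))  ≡⟨ cong (negOnePow j *ˢ_) (sym (antiperiodic-at-hs m k)) ⟩
    negOnePow j *ˢ a (hs m + k * T)           ∎
    where T = two^ (suc m)

  -- On F m the period 2^(m+1) is an antiperiod, so it is not a period.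
  F-not-periodic : ∀ {m x} → F m x → ¬ Periodic a (suc m) x
  F-not-periodic {x = x} f per = SP.s≢opposite[s] (a x) (trans (sym (per (+ 1))) (antiperiodic f (+ 1)))

  -- Two antiperiods make a period: a is 2^(p+1)-periodic on F m for all p > m.
  F-periodic-above : ∀ {m n x} → m < n → F m x → Periodic a (suc n) x
  F-periodic-above {m} {x = x} m<n f = periodic-mono a x (ℕP.≤⇒≤′ (s≤s m<n)) F-periodic
    where F-periodic : Periodic a (suc (suc m)) x
          F-periodic k = trans (cong a (double-step x k (suc m)))
            (trans (antiperiodic f (k + k)) (cong (_*ˢ a x) (negOnePow-double k)))

  -- The cosets F i are pairwise disjoint: on F i the period 2^(j+1) would be an antiperiod.
  F-disjoint : ∀ {i j x} → i < j → F i x → F j x → ⊥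
  F-disjoint i<j fi fj = F-not-periodic fj (F-periodic-above i<j fi)

  F-unique : ∀ {i j x} → F i x → F j x → i ≡ j
  F-unique {i} {j} fi fj with ℕP.<-cmp i j
  ... | tri< i<j _ _ = ⊥-elim (F-disjoint i<j fi fj)
  ... | tri≈ _ i≡j _ = i≡j
  ... | tri> _ _ j<i = ⊥-elim (F-disjoint j<i fj fi)

  F-symmetric : ∀ {m x} → F m x → a (x - two^ (suc m)) ≡ a (x + two^ (suc m))
  F-symmetric {m} {x} f = begin
    a (x - T)              ≡⟨ cong a (minus-one x T) ⟩
    a (x + - + 1 * T)      ≡⟨ antiperiodic f (- + 1) ⟩
    opposite (a x)         ≡⟨ sym (antiperiodic f (+ 1)) ⟩
    a (x + + 1 * T)        ≡⟨ cong (λ y → a (x + y)) (ℤP.*-identityˡ T) ⟩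
    a (x + T)              ∎
    where T = two^ (suc m)
          minus-one : ∀ x t → x - t ≡ x + - + 1 * t
          minus-one = solve-∀

  Covered : ℕ → Set
  Covered n = ∀ h → E n h ⊎ ∃ λ j → j < n × F j h

  -- Given the cover at level n, hs (n+1) lies in E n ∖ F n; so E (n+1) = E n ∖ F n.
  next-centre : ∀ n → Covered n → hs (suc n) ≡ hs n + two^ n [mod2^ suc n ]
  next-centre n cover with cover (hs (suc n))
  ... | inj₂ (j , j<n , f) = ⊥-elim (F-disjoint (ℕP.m<n⇒m<1+n j<n) f ≡mod-refl)
  ... | inj₁ e with ≡mod-split e
  ...   | inj₁ f = ⊥-elim (F-disjoint (ℕP.n<1+n n) f ≡mod-refl)
  ...   | inj₂ g = g

  -- By induction: E n splits into F n and E n ∖ F n = E (n+1).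
  covered : ∀ n → Covered n
  covered zero h = inj₁ (congruent (h - hs zero , ring h (hs zero)))
    where ring : ∀ h c → h ≡ c + (h - c) * + 1
          ring = solve-∀
  covered (suc n) h with covered n h
  ... | inj₂ (j , j<n , f) = inj₂ (j , ℕP.m<n⇒m<1+n j<n , f)
  ... | inj₁ e with ≡mod-split e
  ...   | inj₁ f = inj₂ (n , ℕP.n<1+n n , f)
  ...   | inj₂ g = inj₁ (≡mod-trans g (≡mod-sym (next-centre n (covered n))))

  -- Off E n the cover places h in some F j with j < n, where a is 2^(n+1)-periodic.
  off-E-covered : ∀ {n h} → ¬ E n h → ∃ λ j → j < n × F j h
  off-E-covered {n} {h} h∉E with covered n h
  ... | inj₁ h∈E = ⊥-elim (h∉E h∈E)
  ... | inj₂ j-cover = j-cover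

  periodic-off-E : ∀ {n h} → ¬ E n h → Periodic a (suc n) h
  periodic-off-E h∉E with off-E-covered h∉E
  ... | j , j<n , f = F-periodic-above j<n f

  -- On E n the point is in F n (antiperiodic) or shares its period with hs (n+1) ∈ F (n+1).
  not-periodic-on-E : ∀ {n h} → E n h → ¬ Periodic a (suc n) h
  not-periodic-on-E {n} e per with ≡mod-split e
  ... | inj₁ f = F-not-periodic f per
  ... | inj₂ g = F-not-periodic {suc n} ≡mod-refl (periodic-double a (suc n) (hs (suc n))
          (periodic-transfer a per (≡mod-trans (next-centre n (covered n)) (≡mod-sym g))))

  E-suc-neighbours : ∀ {m h} → E (suc m) h → F m (h - two^ m) × F m (h + two^ m)
  E-suc-neighbours {m} {h} e = below , subst (λ z → F m z) (across h m) (≡mod-shift below (+ 1))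
    where
    ring : ∀ c t x → c + t + x - t ≡ c + x
    ring = solve-∀
    below : F m (h - two^ m)
    below with ≡mod-trans e (next-centre m (covered m))
    ... | congruent (k , refl) = congruent (k , ring (hs m) (two^ m) (k * two^ (suc m)))

  -- The right arm of the ball about l ∈ E m avoids E m, so it is 2^(m+1)-periodic.
  arm-periodic : ∀ {m l} → E m l →
    window a (l + + 1) (radius m) ≡ window a (l + + 1 * two^ (suc m) + + 1) (radius m)
  arm-periodic {m} {l} e =
    window-cong a (l + + 1) (l + + 1 * two^ (suc m) + + 1) (radius m) pointwise
    where
    ring : ∀ l i t → l + + 1 + i + + 1 * t ≡ l + + 1 * t + + 1 + i
    ring = solve-∀
    pointwise : ∀ {i} → i < radius m → a (l + + 1 + + i) ≡ a (l + + 1 * two^ (suc m) + + 1 + + i)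
    pointwise {i} i<r with covered m (l + + 1 + + i)
    ... | inj₁ e′ = ⊥-elim (offset-incongruent (subst (suc i <_) (suc-radius m) (s≤s i<r))
                      (≡mod-trans (subst (λ z → z ≡ hs m [mod2^ m ]) (ℤP.+-assoc l (+ 1) (+ i)) e′)
                                  (≡mod-sym e)))
    ... | inj₂ (j , j<m , f) =
      trans (sym (F-periodic-above j<m f (+ 1))) (cong a (ring l (+ i) (two^ (suc m))))

  reflected-balls : ∀ {m h} → (∀ c → E m c → Folding (suc m) (ball a c (radius m))) → E (suc m) h →
    ball a (h - two^ m) (radius m) ≡ bar (ball a (h + two^ m) (radius m))
  reflected-balls {m} {h} folding e =
    trans (sym (bar-involutive (ball a l r))) (cong bar (begin
      bar (ball a l r)                  ≡⟨ cong bar (folding-ball-centred a l m (folding l (≡mod-weaken fl))) ⟩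
      bar (bar Wl ++ a l ∷ Wl)          ≡⟨ bar-antisymmetric Wl (a l) ⟩
      bar Wl ++ opposite (a l) ∷ Wl     ≡⟨ cong₂ (λ x ys → bar ys ++ x ∷ ys) centres arms ⟩
      bar Wu ++ a u ∷ Wu                ≡⟨ sym (folding-ball-centred a u m (folding u (≡mod-weaken fu))) ⟩
      ball a u r                        ∎))
    where
    r = radius m
    l = h - two^ m
    u = h + two^ m
    fl = proj₁ (E-suc-neighbours e)
    fu = proj₂ (E-suc-neighbours e)
    Wl = window a (l + + 1) r
    Wu = window a (u + + 1) r
    centres : opposite (a l) ≡ a u
    centres = trans (sym (antiperiodic fl (+ 1))) (cong a (across h m))
    arms : Wl ≡ Wu
    arms = trans (arm-periodic (≡mod-weaken fl)) (cong (λ z → window a (z + + 1) r) (across h m))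

  folding-ball : ∀ n h → E n h → Folding (suc n) (ball a h (radius n))
  folding-ball zero h _ = subst (Folding 1) (sym (ball-arms a h 0)) (foldS fold0 (a h))
  folding-ball (suc m) h e =
    subst (Folding (suc (suc m))) (sym decomposition) (foldS (folding-ball m u eu) (a h))
    where
    r = radius m
    u = h + two^ m
    eu = ≡mod-weaken (proj₂ (E-suc-neighbours e))
    decomposition : ball a h (radius (suc m)) ≡ bar (ball a u r) ++ a h ∷ ball a u r
    decomposition = begin
      ball a h (radius (suc m))
        ≡⟨ ball-double a h r ⟩
      ball a (h - + suc r) r ++ a h ∷ ball a (h + + suc r) r
        ≡⟨ cong (λ t → ball a (h - t) r ++ a h ∷ ball a (h + t) r) (sym (two^-radius m)) ⟩
      ball a (h - two^ m) r ++ a h ∷ ball a u r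
        ≡⟨ cong (_++ a h ∷ ball a u r) (reflected-balls (folding-ball m) e) ⟩
      bar (ball a u r) ++ a h ∷ ball a u r
        ∎

  folding-ball-centre : ∀ n h → Folding (suc (suc n)) (ball a h (radius (suc n))) → E n h
  folding-ball-centre n h fold with covered n h
  ... | inj₁ h∈E = h∈E
  ... | inj₂ (j , j<n , f) =
    ⊥-elim (SP.s≢opposite[s] (a (h + T)) (trans (sym (F-symmetric f)) antisymmetric))
    where
    T = two^ (suc j)
    R = radius (suc n)
    q = radius (suc j)
    fits : suc q ≤ R
    fits = ℕP.≤-trans (s≤s (radius-mono (ℕP.≤⇒≤′ j<n))) (ℕP.m≤n+m (suc (radius n)) (radius n))
    mirror : window a (h - + (R ∸ suc q ℕ.+ suc q)) (R ∸ suc q ℕ.+ suc q)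
           ≡ bar (window a (h + + 1) (R ∸ suc q ℕ.+ suc q))
    mirror = subst (λ L → window a (h - + L) L ≡ bar (window a (h + + 1) L))
                   (sym (ℕP.m∸n+n≡m fits)) (folding-ball-antisymmetric a h (suc n) fold)
    antisymmetric : a (h - T) ≡ opposite (a (h + T))
    antisymmetric = subst (λ t → a (h - t) ≡ opposite (a (h + t))) (sym (two^-radius (suc j)))
                          (antisymmetric-at a h (R ∸ suc q) q mirror)

proposition1p1 : (a : ℤ → Sign) (hs : ℕ → ℤ) →
    (∀ (n : ℕ) (k : ℤ) → a (hs n + k * two^ (suc n)) ≡ negOnePow k *ˢ a (hs n)) →
    ∀ (n : ℕ) →
      ((∀ (h : ℤ) → (¬ InCoset (hs n) (two^ n) h) ⇔ (∀ (k : ℤ) → a (h + k * two^ (suc n)) ≡ a h))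
      × (∀ (h : ℤ) → (¬ InCoset (hs n) (two^ n) h) ⇔ (∃ λ (i : ℕ) → (i < n) × InCoset (hs i) (two^ (suc i)) h))
      × (∀ (h : ℤ) (i j : ℕ) → i < n → j < n → InCoset (hs i) (two^ (suc i)) h → InCoset (hs j) (two^ (suc j)) h → i ≡ j))
      × (∀ (h : ℤ) → InCoset (hs n) (two^ n) h →
          Folding (suc n) (window a (h - two^ n + + 1) (2 ^ suc n ∸ 1)))
      × (∀ (h : ℤ) → Folding (suc (suc n)) (window a (h - two^ (suc n) + + 1) (2 ^ suc (suc n) ∸ 1)) →
          InCoset (hs n) (two^ n) h)
proposition1p1 a hs H n =
    ( (λ h → mk⇔ (λ h∉E → periodic-off-E (h∉E ∘ coset))
                 (λ per h∈E → not-periodic-on-E (congruent h∈E) per))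
    , (λ h → mk⇔ (λ h∉E → let (j , j<n , f) = off-E-covered (h∉E ∘ coset) in j , j<n , coset f)
                 (λ { (j , j<n , f) h∈E → not-periodic-on-E (congruent h∈E) (F-periodic-above j<n (congruent f)) }))
    , (λ h i j _ _ fi fj → F-unique (congruent fi) (congruent fj)) )
  , (λ h h∈E → subst (Folding (suc n)) (sym (window≡ball a h n)) (folding-ball n h (congruent h∈E)))
  , (λ h fold → coset (folding-ball-centre n h (subst (Folding (suc (suc n))) (window≡ball a h (suc n)) fold)))
  where open Antiperiodic a hs H
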